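{- Let $k\ge 0$ be an integer, let $p_1,\dots,p_k$ be distinct primes, and let $\Gamma_k$ be the $k$-dprime divisor function graph of $n=p_1p_2\cdots p_k$. Then the Harary index of $\Gamma_k$ is $$H(\Gamma_k)=\frac{2^{k-1}(2^k-3)+3^k}{2}.$$
   Context: For $n=p_1p_2\cdots p_k$ with $p_1,\dots,p_k$ distinct primes, the $k$-dprime divisor function graph $\Gamma_k=G_{D(n)}$ is the simple graph with vertex set $V(\Gamma_k)=\{u\in\mathbb{Z}_{>0}: u\mid n\}$ and edge set $E(\Gamma_k)=\{uv: u\neq v,\ u\mid v \text{ or } v\mid u\}$. The Harary index is $H(\Gamma_k)=\sum_{\{u,v\}\subseteq V(\Gamma_k)} \frac{1}{d_{\Gamma_k}(u,v)}$, summed over unordered pairs of distinct vertices, where $d_{\Gamma_k}$ is the shortest-path distance. -}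

module Defs where

open import Data.Bool using (Bool; true; false; _∧_; _∨_; not; if_then_else_)
open import Data.Nat using (ℕ; zero; suc; _≡ᵇ_; _^_)
open import Data.Nat.Divisibility using (_∣?_)
open import Data.List using (List; []; _∷_; map; filter; length; foldr; _++_; upTo)
open import Data.Bool.ListAction using (any)
open import Data.Product using (_×_; _,_)
open import Data.Rational using (ℚ; 0ℚ; _+_; _*_)
import Data.Rational as ℚ
open import Data.Integer using (+_)
import Data.Integer as ℤ
open import Relation.Nullary.Decidable using (isYes)

-- A finite simple graph given by a duplicate-free vertex list and a
-- Boolean adjacency relation.
record FinGraph : Set where
  field
    vertices : List ℕ
    adj      : ℕ → ℕ → Bool

open FinGraph public

divisorGraph : ℕ → FinGraph
divisorGraph n = record
  { vertices = filter (λ u → u ∣? n) (map suc (upTo n))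
  ; adj      = λ u v → not (u ≡ᵇ v) ∧ (isYes (u ∣? v) ∨ isYes (v ∣? u))
  }

walkOfLength : FinGraph → ℕ → ℕ → ℕ → Bool
walkOfLength G zero    u v = u ≡ᵇ v
walkOfLength G (suc m) u v =
  any (λ w → adj G u w ∧ walkOfLength G m w v) (vertices G)

-- least i in [start, start + fuel] with P i (default 0 if none).
leastFrom : (ℕ → Bool) → ℕ → ℕ → ℕ
leastFrom P zero       i = if P i then i else 0
leastFrom P (suc fuel) i = if P i then i else leastFrom P fuel (suc i)

-- A shortest walk is a path, so its length is at most |V|; searching
-- m ∈ [0, |V|] is therefore exact for vertices in the same component.
dist : FinGraph → ℕ → ℕ → ℕ
dist G u v = leastFrom (λ m → walkOfLength G m u v) (length (vertices G)) 0

pairs : List ℕ → List (ℕ × ℕ)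
pairs []       = []
pairs (x ∷ xs) = map (x ,_) xs ++ pairs xs

-- 1/d as a rational (d = 0 never occurs for distinct vertices).
inv : ℕ → ℚ
inv zero    = 0ℚ
inv (suc d) = (+ 1) ℚ./ suc d

sumℚ : List ℚ → ℚ
sumℚ = foldr _+_ 0ℚ

harary : FinGraph → ℚ
harary G = sumℚ (map (λ { (u , v) → inv (dist G u v) }) (pairs (vertices G)))

-- (2^(k-1) (2^k - 3) + 3^k) / 2, with 2^(k-1) read as the rational 2^k / 2.
half : ℚ
half = (+ 1) ℚ./ 2

hararyFormula : ℕ → ℚ
hararyFormula k =
  half * ((half * ((+ (2 ^ k) ℤ.* (+ (2 ^ k) ℤ.- + 3)) ℚ./ 1)) + ((+ (3 ^ k)) ℚ./ 1))

-- Every divisor is adjacent to 1, so two distinct divisors are at distance 1 when one divides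
-- the other and at distance 2 otherwise; hence 2H is the number of unordered pairs plus the
-- number of comparable ones. Listing the divisors of q · m as D ++ q · D, where D lists those
-- of m, the ordered divisibility pairs triple (3^k in all) and the pair sum obeys a linear
-- recursion, solved by 2^(k-1) (2^k - 1) + 3^k - 2^k = 2^(k-1) (2^k - 3) + 3^k.
module Submission where

open import Algebra.Properties.CommutativeSemigroup using (interchange)
open import Data.Bool using (Bool; true; false; _∧_; _∨_; if_then_else_)
open import Data.Bool.ListAction using (any)
open import Data.Bool.Properties using (∨-comm; ∨-zeroʳ; ∨-identityʳ; ∧-zeroʳ; T-≡)
open import Data.Fin using (Fin; zero; suc)
import Data.Fin.Properties as Fin
open import Data.Integer using (ℤ; -[1+_]; +0; +[1+_])
import Data.Integer as ℤ
import Data.Integer.Properties as ℤ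
open import Data.List using (List; []; _∷_; _++_; map; length; upTo)
open import Data.List.Properties using (map-++; map-∘; map-cong; length-++; length-map)
open import Data.List.Membership.Propositional using (_∈_; lose)
open import Data.List.Membership.Propositional.Properties
  using (∈-map⁺; ∈-map⁻; ∈-++⁺ˡ; ∈-++⁺ʳ; ∈-filter⁺; ∈-filter⁻; ∈-upTo⁺)
open import Data.List.Membership.Propositional.Properties.WithK using (unique∧set⇒bag)
open import Data.List.Relation.Binary.BagAndSetEquality using (∼bag⇒↭)
open import Data.List.Relation.Binary.Permutation.Propositional as ↭ using (_↭_)
import Data.List.Relation.Binary.Permutation.Propositional.Properties as ↭
open import Data.List.Relation.Unary.All as All using (All; []; _∷_)
import Data.List.Relation.Unary.All.Properties as All
open import Data.List.Relation.Unary.Any using (here; there)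
open import Data.List.Relation.Unary.Any.Properties using (any⁺)
open import Data.List.Relation.Unary.AllPairs using ([]; _∷_)
open import Data.List.Relation.Unary.Unique.Propositional using (Unique)
import Data.List.Relation.Unary.Unique.Propositional.Properties as Unique
open import Data.Nat using (ℕ; zero; suc; _+_; _*_; _^_; _≤_; _≡ᵇ_; _≟_; NonZero; ≢-nonZero⁻¹; s≤s; z≤n)
open import Data.Nat.Coprimality using (Coprime; coprime-divisor)
import Data.Nat.Coprimality as C
open import Data.Nat.Divisibility
open import Data.Nat.ListAction using (sum)
open import Data.Nat.ListAction.Properties using (sum-++; sum-↭)
open import Data.Nat.Primality using (Prime; prime⇒irreducible; prime⇒nonZero; ¬prime[1]; euclidsLemma)
open import Data.Nat.Properties
  using (+-commutativeSemigroup; +-identityʳ; *-comm; suc-injective; *-identityʳ; *-zeroʳ; *-cancelˡ-≡; m*n≢0; <⇒≤)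
open import Data.Nat.Solver using (module +-*-Solver)
open import Data.Product using (_×_; _,_; proj₂)
open import Data.Rational using (ℚ; mkℚ; -_)
import Data.Rational as ℚ
import Data.Rational.Properties as ℚ
import Data.Rational.Solver as ℚ-Solver
open import Data.Sum using (inj₁; inj₂)
open import Data.Vec.Functional using (foldr; head; tail)
open import Defs
open import Function using (_∘_; _⇔_; mk⇔; Equivalence)
open import Function.Definitions using (Injective)
import Function.Properties.Equivalence as ⇔
open import Relation.Binary.PropositionalEquality
open import Relation.Nullary using (¬_; yes; no; contradiction)
open import Relation.Nullary.Decidable using (isYes; isYes≗does; does-⇔; dec-true; dec-false)

open +-*-Solver using (solve; _:+_; _:*_; _:=_; con)

∑ : (ℕ → ℕ) → List ℕ → ℕ
∑ f xs = sum (map f xs)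

∑∑ : (ℕ → ℕ → ℕ) → List ℕ → List ℕ → ℕ
∑∑ g xs ys = ∑ (λ x → ∑ (g x) ys) xs

∑pairs : (ℕ → ℕ → ℕ) → List ℕ → ℕ
∑pairs g []       = 0
∑pairs g (x ∷ xs) = ∑ (g x) xs + ∑pairs g xs

∑-++ : ∀ f xs ys → ∑ f (xs ++ ys) ≡ ∑ f xs + ∑ f ys
∑-++ f xs ys = trans (cong sum (map-++ f xs ys)) (sum-++ (map f xs) (map f ys))

∑-map : ∀ f g xs → ∑ f (map g xs) ≡ ∑ (f ∘ g) xs
∑-map f g xs = cong sum (sym (map-∘ xs))

∑-cong : ∀ {f g} → (∀ x → f x ≡ g x) → ∀ xs → ∑ f xs ≡ ∑ g xs
∑-cong f≗g xs = cong sum (map-cong f≗g xs)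

∑-congᴬ : ∀ {P : ℕ → Set} {f g xs} → All P xs → (∀ {x} → P x → f x ≡ g x) → ∑ f xs ≡ ∑ g xs
∑-congᴬ []         f≡g = refl
∑-congᴬ (px ∷ pxs) f≡g = cong₂ _+_ (f≡g px) (∑-congᴬ pxs f≡g)

∑-+ : ∀ f g xs → ∑ (λ x → f x + g x) xs ≡ ∑ f xs + ∑ g xs
∑-+ f g []       = refl
∑-+ f g (x ∷ xs) =
  trans (cong ((f x + g x) +_) (∑-+ f g xs)) (interchange +-commutativeSemigroup (f x) (g x) (∑ f xs) (∑ g xs))

∑-const : ∀ c xs → ∑ (λ _ → c) xs ≡ length xs * c
∑-const c []       = refl
∑-const c (x ∷ xs) = cong (c +_) (∑-const c xs)

∑-↭ : ∀ f {xs ys} → xs ↭ ys → ∑ f xs ≡ ∑ f ys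
∑-↭ f xs↭ys = sum-↭ (↭.map⁺ f xs↭ys)

∑∑-++ˡ : ∀ g xs xs′ ys → ∑∑ g (xs ++ xs′) ys ≡ ∑∑ g xs ys + ∑∑ g xs′ ys
∑∑-++ˡ g xs xs′ ys = ∑-++ _ xs xs′

∑∑-++ʳ : ∀ g xs ys ys′ → ∑∑ g xs (ys ++ ys′) ≡ ∑∑ g xs ys + ∑∑ g xs ys′
∑∑-++ʳ g xs ys ys′ = trans (∑-cong (λ x → ∑-++ (g x) ys ys′) xs) (∑-+ _ _ xs)

∑∑-mapˡ : ∀ g φ xs ys → ∑∑ g (map φ xs) ys ≡ ∑∑ (g ∘ φ) xs ys
∑∑-mapˡ g φ xs ys = ∑-map _ φ xs

∑∑-mapʳ : ∀ g φ xs ys → ∑∑ g xs (map φ ys) ≡ ∑∑ (λ x → g x ∘ φ) xs ys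
∑∑-mapʳ g φ xs ys = ∑-cong (λ x → ∑-map (g x) φ ys) xs

∑∑-congᴬ : ∀ {P : ℕ → Set} {g h xs ys} → All P xs → All P ys →
           (∀ {x y} → P x → P y → g x y ≡ h x y) → ∑∑ g xs ys ≡ ∑∑ h xs ys
∑∑-congᴬ pxs pys g≡h = ∑-congᴬ pxs (λ px → ∑-congᴬ pys (g≡h px))

∑∑-+ : ∀ g h xs ys → ∑∑ (λ x y → g x y + h x y) xs ys ≡ ∑∑ g xs ys + ∑∑ h xs ys
∑∑-+ g h xs ys = trans (∑-cong (λ x → ∑-+ (g x) (h x) ys) xs) (∑-+ _ _ xs)

∑∑-const : ∀ c xs ys → ∑∑ (λ _ _ → c) xs ys ≡ length xs * (length ys * c)
∑∑-const c xs ys = trans (∑-cong (λ _ → ∑-const c ys) xs) (∑-const _ xs)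

∑pairs-++ : ∀ g xs ys → ∑pairs g (xs ++ ys) ≡ ∑pairs g xs + ∑∑ g xs ys + ∑pairs g ys
∑pairs-++ g []       ys = refl
∑pairs-++ g (x ∷ xs) ys rewrite ∑-++ (g x) xs ys | ∑pairs-++ g xs ys =
  solve 5 (λ a b c d e → (a :+ b) :+ ((c :+ d) :+ e) := ((a :+ c) :+ (b :+ d)) :+ e) refl
    (∑ (g x) xs) (∑ (g x) ys) (∑pairs g xs) (∑∑ g xs ys) (∑pairs g ys)

∑pairs-map : ∀ g φ → (∀ x y → g (φ x) (φ y) ≡ g x y) → ∀ xs → ∑pairs g (map φ xs) ≡ ∑pairs g xs
∑pairs-map g φ g∘φ≡g []       = refl
∑pairs-map g φ g∘φ≡g (x ∷ xs) =
  cong₂ _+_ (trans (∑-map (g (φ x)) φ xs) (∑-cong (g∘φ≡g x) xs)) (∑pairs-map g φ g∘φ≡g xs)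

∑pairs-↭ : ∀ {g} → (∀ x y → g x y ≡ g y x) → ∀ {xs ys} → xs ↭ ys → ∑pairs g xs ≡ ∑pairs g ys
∑pairs-↭ g-sym ↭.refl                = refl
∑pairs-↭ {g} g-sym (↭.prep x p)      = cong₂ _+_ (∑-↭ (g x) p) (∑pairs-↭ g-sym p)
∑pairs-↭ {g} g-sym (↭.swap {ys = ys} x y p) =
  trans (cong₂ _+_ (cong₂ _+_ (g-sym x y) (∑-↭ (g x) p)) (cong₂ _+_ (∑-↭ (g y) p) (∑pairs-↭ g-sym p)))
        (interchange +-commutativeSemigroup (g y x) (∑ (g x) ys) (∑ (g y) ys) (∑pairs g ys))
∑pairs-↭ g-sym (↭.trans p q)       = trans (∑pairs-↭ g-sym p) (∑pairs-↭ g-sym q)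

_∣ᵇ_ : ℕ → ℕ → Bool
u ∣ᵇ v = isYes (u ∣? v)

𝟙 : Bool → ℕ
𝟙 false = 0
𝟙 true  = 1

comparableᵇ : ℕ → ℕ → Bool
comparableᵇ u v = u ∣ᵇ v ∨ v ∣ᵇ u

𝟙∣ : ℕ → ℕ → ℕ
𝟙∣ u v = 𝟙 (u ∣ᵇ v)

-- 2 / d(u, v) for distinct vertices of a divisor graph (inv-dist-divisorGraph).
twiceInvDist : ℕ → ℕ → ℕ
twiceInvDist u v = suc (𝟙 (comparableᵇ u v))

twiceInvDist-sym : ∀ u v → twiceInvDist u v ≡ twiceInvDist v u
twiceInvDist-sym u v = cong (suc ∘ 𝟙) (∨-comm (u ∣ᵇ v) (v ∣ᵇ u))

∣ᵇ-⇔ : ∀ {a b c d} → a ∣ b ⇔ c ∣ d → a ∣ᵇ b ≡ c ∣ᵇ d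
∣ᵇ-⇔ {a} {b} {c} {d} eq =
  trans (isYes≗does (a ∣? b)) (trans (does-⇔ eq (a ∣? b) (c ∣? d)) (sym (isYes≗does (c ∣? d))))

∣ᵇ-false : ∀ {a b} → ¬ a ∣ b → a ∣ᵇ b ≡ false
∣ᵇ-false {a} {b} a∤b = trans (isYes≗does (a ∣? b)) (dec-false (a ∣? b) a∤b)

1∣ᵇ : ∀ n → 1 ∣ᵇ n ≡ true
1∣ᵇ n = trans (isYes≗does (1 ∣? n)) (dec-true (1 ∣? n) (1∣ n))

*-cancelˡ-∣ᵇ : ∀ q .{{_ : NonZero q}} a b → (q * a) ∣ᵇ (q * b) ≡ a ∣ᵇ b
*-cancelˡ-∣ᵇ q a b = ∣ᵇ-⇔ (mk⇔ (*-cancelˡ-∣ q) (*-monoʳ-∣ q))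

prime∤⇒coprime : ∀ {q d} → Prime q → ¬ q ∣ d → Coprime d q
prime∤⇒coprime q-prime q∤d (i∣d , i∣q) with prime⇒irreducible q-prime i∣q
... | inj₁ i≡1  = i≡1
... | inj₂ refl = contradiction i∣d q∤d

module _ {q m : ℕ} (q-prime : Prime q) (q∤m : ¬ q ∣ m) where

  private instance
    q≢0 : NonZero q
    q≢0 = prime⇒nonZero q-prime

  ∣ᵇ-*ʳ : ∀ {a} b → a ∣ m → a ∣ᵇ (q * b) ≡ a ∣ᵇ b
  ∣ᵇ-*ʳ b a∣m = ∣ᵇ-⇔ (mk⇔ (coprime-divisor (prime∤⇒coprime q-prime (λ q∣a → q∤m (∣-trans q∣a a∣m))))
                           (∣n⇒∣m*n q))

  *∣ᵇ-false : ∀ {a} b → a ∣ m → (q * b) ∣ᵇ a ≡ false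
  *∣ᵇ-false b a∣m = ∣ᵇ-false (λ qb∣a → q∤m (∣-trans (m∣m*n b) (∣-trans qb∣a a∣m)))

  twiceInvDist-*-* : ∀ a b → twiceInvDist (q * a) (q * b) ≡ twiceInvDist a b
  twiceInvDist-*-* a b rewrite *-cancelˡ-∣ᵇ q a b | *-cancelˡ-∣ᵇ q b a = refl

  twiceInvDist-* : ∀ {a} b → a ∣ m → twiceInvDist a (q * b) ≡ suc (𝟙∣ a b)
  twiceInvDist-* {a} b a∣m rewrite ∣ᵇ-*ʳ b a∣m | *∣ᵇ-false b a∣m = cong (suc ∘ 𝟙) (∨-identityʳ (a ∣ᵇ b))

  module Doubling {A : List ℕ} (A∣m : All (_∣ m) A) where

    qA : List ℕ
    qA = map (q *_) A

    ∑∑-𝟙∣-doubling : ∑∑ 𝟙∣ (A ++ qA) (A ++ qA) ≡ 3 * ∑∑ 𝟙∣ A A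
    ∑∑-𝟙∣-doubling = begin
      ∑∑ 𝟙∣ (A ++ qA) (A ++ qA)                          ≡⟨ ∑∑-++ˡ 𝟙∣ A qA (A ++ qA) ⟩
      ∑∑ 𝟙∣ A (A ++ qA) + ∑∑ 𝟙∣ qA (A ++ qA)              ≡⟨ cong₂ _+_ (∑∑-++ʳ 𝟙∣ A A qA) (∑∑-++ʳ 𝟙∣ qA A qA) ⟩
      (∑∑ 𝟙∣ A A + ∑∑ 𝟙∣ A qA) + (∑∑ 𝟙∣ qA A + ∑∑ 𝟙∣ qA qA) ≡⟨ cong₂ _+_ (cong (∑∑ 𝟙∣ A A +_) A×qA) (cong₂ _+_ qA×A qA×qA) ⟩
      (∑∑ 𝟙∣ A A + ∑∑ 𝟙∣ A A) + (0 + ∑∑ 𝟙∣ A A)            ≡⟨ solve 1 (λ x → (x :+ x) :+ (con 0 :+ x) := con 3 :* x) refl (∑∑ 𝟙∣ A A) ⟩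
      3 * ∑∑ 𝟙∣ A A                                      ∎
      where
      open ≡-Reasoning
      A×qA : ∑∑ 𝟙∣ A qA ≡ ∑∑ 𝟙∣ A A
      A×qA = trans (∑∑-mapʳ 𝟙∣ (q *_) A A)
                   (∑∑-congᴬ A∣m A∣m (λ {a} {b} a∣m _ → cong 𝟙 (∣ᵇ-*ʳ b a∣m)))
      qA×A : ∑∑ 𝟙∣ qA A ≡ 0
      qA×A = begin
        ∑∑ 𝟙∣ qA A                 ≡⟨ ∑∑-mapˡ 𝟙∣ (q *_) A A ⟩
        ∑∑ (𝟙∣ ∘ (q *_)) A A       ≡⟨ ∑∑-congᴬ A∣m A∣m (λ {a} _ b∣m → cong 𝟙 (*∣ᵇ-false a b∣m)) ⟩
        ∑∑ (λ _ _ → 0) A A         ≡⟨ ∑∑-const 0 A A ⟩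
        length A * (length A * 0)  ≡⟨ cong (length A *_) (*-zeroʳ (length A)) ⟩
        length A * 0               ≡⟨ *-zeroʳ (length A) ⟩
        0                          ∎
      qA×qA : ∑∑ 𝟙∣ qA qA ≡ ∑∑ 𝟙∣ A A
      qA×qA = trans (∑∑-mapˡ 𝟙∣ (q *_) A qA)
              (trans (∑∑-mapʳ _ (q *_) A A) (∑-cong (λ a → ∑-cong (cong 𝟙 ∘ *-cancelˡ-∣ᵇ q a) A) A))

    ∑pairs-doubling : ∑pairs twiceInvDist (A ++ qA) ≡
                      ∑pairs twiceInvDist A + (length A * length A + ∑∑ 𝟙∣ A A) + ∑pairs twiceInvDist A
    ∑pairs-doubling =
      trans (∑pairs-++ twiceInvDist A qA)
            (cong₂ (λ x y → ∑pairs twiceInvDist A + x + y) A×qA (∑pairs-map _ (q *_) twiceInvDist-*-* A))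
      where
      open ≡-Reasoning
      A×qA : ∑∑ twiceInvDist A qA ≡ length A * length A + ∑∑ 𝟙∣ A A
      A×qA = begin
        ∑∑ twiceInvDist A qA                      ≡⟨ ∑∑-mapʳ twiceInvDist (q *_) A A ⟩
        ∑∑ (λ a b → twiceInvDist a (q * b)) A A   ≡⟨ ∑∑-congᴬ A∣m A∣m (λ {a} {b} a∣m _ → twiceInvDist-* b a∣m) ⟩
        ∑∑ (λ a b → 1 + 𝟙∣ a b) A A              ≡⟨ ∑∑-+ (λ _ _ → 1) 𝟙∣ A A ⟩
        ∑∑ (λ _ _ → 1) A A + ∑∑ 𝟙∣ A A           ≡⟨ cong (_+ ∑∑ 𝟙∣ A A) (∑∑-const 1 A A) ⟩
        length A * (length A * 1) + ∑∑ 𝟙∣ A A     ≡⟨ cong (λ x → length A * x + ∑∑ 𝟙∣ A A) (*-identityʳ (length A)) ⟩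
        length A * length A + ∑∑ 𝟙∣ A A          ∎

∏ : ∀ {k} → (Fin k → ℕ) → ℕ
∏ = foldr _*_ 1

divisorList : ∀ k → (Fin k → ℕ) → List ℕ
divisorList zero    p = 1 ∷ []
divisorList (suc k) p = D ++ map (head p *_) D
  where D = divisorList k (tail p)

prime∣prime⇒≡ : ∀ {q r} → Prime q → Prime r → q ∣ r → q ≡ r
prime∣prime⇒≡ q-prime r-prime q∣r with prime⇒irreducible r-prime q∣r
... | inj₁ refl = contradiction q-prime ¬prime[1]
... | inj₂ q≡r  = q≡r

prime∤∏ : ∀ {k q} (p : Fin k → ℕ) → Prime q → (∀ i → Prime (p i)) → (∀ i → q ≢ p i) → ¬ q ∣ ∏ p
prime∤∏ {zero}  p q-prime p-prime q≢p q∣1 = ¬prime[1] (subst Prime (∣1⇒≡1 q∣1) q-prime)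
prime∤∏ {suc k} p q-prime p-prime q≢p q∣∏ with euclidsLemma (head p) (∏ (tail p)) q-prime q∣∏
... | inj₁ q∣p₀ = q≢p zero (prime∣prime⇒≡ q-prime (p-prime zero) q∣p₀)
... | inj₂ q∣∏ₜ = prime∤∏ (tail p) q-prime (p-prime ∘ suc) (q≢p ∘ suc) q∣∏ₜ

head∤∏tail : ∀ {k} (p : Fin (suc k) → ℕ) → (∀ i → Prime (p i)) → Injective _≡_ _≡_ p → ¬ head p ∣ ∏ (tail p)
head∤∏tail p p-prime p-inj = prime∤∏ (tail p) (p-prime zero) (p-prime ∘ suc) (λ i → Fin.0≢1+n ∘ p-inj)

∏-nonZero : ∀ {k} (p : Fin k → ℕ) → (∀ i → Prime (p i)) → NonZero (∏ p)
∏-nonZero {zero}  p p-prime = _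
∏-nonZero {suc k} p p-prime =
  m*n≢0 (head p) (∏ (tail p)) {{prime⇒nonZero (p-prime zero)}} {{∏-nonZero (tail p) (p-prime ∘ suc)}}

divisorList-∣ : ∀ k p → All (_∣ ∏ p) (divisorList k p)
divisorList-∣ zero    p = ∣-refl ∷ []
divisorList-∣ (suc k) p =
  All.++⁺ (All.map (∣n⇒∣m*n (head p)) D∣) (All.map⁺ (All.map (*-monoʳ-∣ (head p)) D∣))
  where D∣ = divisorList-∣ k (tail p)

∣∏⇒∈divisorList : ∀ k p → (∀ i → Prime (p i)) → ∀ {d} → d ∣ ∏ p → d ∈ divisorList k p
∣∏⇒∈divisorList zero    p p-prime d∣1 = here (∣1⇒≡1 d∣1)
∣∏⇒∈divisorList (suc k) p p-prime {d} d∣∏ with head p ∣? d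
... | yes (divides e refl) =
  ∈-++⁺ʳ D (subst (_∈ map (q *_) D) (*-comm q e)
    (∈-map⁺ (q *_) (IH (*-cancelˡ-∣ q (subst (_∣ q * ∏ (tail p)) (*-comm e q) d∣∏)))))
  where
  q = head p
  D = divisorList k (tail p)
  IH = ∣∏⇒∈divisorList k (tail p) (p-prime ∘ suc)
  instance q≢0 : NonZero q
           q≢0 = prime⇒nonZero (p-prime zero)
... | no q∤d = ∈-++⁺ˡ (∣∏⇒∈divisorList k (tail p) (p-prime ∘ suc)
                        (coprime-divisor (prime∤⇒coprime (p-prime zero) q∤d) d∣∏))

∈-divisorList⇔∣ : ∀ k p → (∀ i → Prime (p i)) → ∀ {d} → d ∈ divisorList k p ⇔ d ∣ ∏ p
∈-divisorList⇔∣ k p p-prime = mk⇔ (All.lookup (divisorList-∣ k p)) (∣∏⇒∈divisorList k p p-prime)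

divisorList-unique : ∀ k p → (∀ i → Prime (p i)) → Injective _≡_ _≡_ p → Unique (divisorList k p)
divisorList-unique zero    p p-prime p-inj = [] ∷ []
divisorList-unique (suc k) p p-prime p-inj =
  Unique.++⁺ D-unique (Unique.map⁺ (*-cancelˡ-≡ _ _ q) D-unique) disjoint
  where
  q = head p
  D = divisorList k (tail p)
  D-unique = divisorList-unique k (tail p) (p-prime ∘ suc) (Fin.suc-injective ∘ p-inj)
  instance q≢0 : NonZero q
           q≢0 = prime⇒nonZero (p-prime zero)
  disjoint : ∀ {v} → ¬ (v ∈ D × v ∈ map (q *_) D)
  disjoint (v∈D , v∈qD) with ∈-map⁻ (q *_) v∈qD
  ... | e , _ , refl = head∤∏tail p p-prime p-inj (∣-trans (m∣m*n e) (All.lookup (divisorList-∣ k (tail p)) v∈D))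

length-divisorList : ∀ k p → length (divisorList k p) ≡ 2 ^ k
length-divisorList zero    p = refl
length-divisorList (suc k) p = begin
  length (D ++ map (head p *_) D)        ≡⟨ length-++ D ⟩
  length D + length (map (head p *_) D)  ≡⟨ cong (length D +_) (length-map (head p *_) D) ⟩
  length D + length D                    ≡⟨ cong (λ l → l + l) (length-divisorList k (tail p)) ⟩
  2 ^ k + 2 ^ k                          ≡⟨ cong (2 ^ k +_) (sym (+-identityʳ (2 ^ k))) ⟩
  2 ^ suc k                              ∎
  where
  open ≡-Reasoning
  D = divisorList k (tail p)

∑∑-𝟙∣-divisorList : ∀ k p → (∀ i → Prime (p i)) → Injective _≡_ _≡_ p →
                    ∑∑ 𝟙∣ (divisorList k p) (divisorList k p) ≡ 3 ^ k
∑∑-𝟙∣-divisorList zero    p p-prime p-inj = refl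
∑∑-𝟙∣-divisorList (suc k) p p-prime p-inj =
  trans ∑∑-𝟙∣-doubling (cong (3 *_) (∑∑-𝟙∣-divisorList k (tail p) (p-prime ∘ suc) (Fin.suc-injective ∘ p-inj)))
  where open Doubling (p-prime zero) (head∤∏tail p p-prime p-inj) (divisorList-∣ k (tail p))

∑pairs-divisorList : ∀ k p → (∀ i → Prime (p i)) → Injective _≡_ _≡_ p →
                     2 * ∑pairs twiceInvDist (divisorList k p) + 3 * 2 ^ k ≡ 2 ^ k * 2 ^ k + 2 * 3 ^ k
∑pairs-divisorList zero    p p-prime p-inj = refl
∑pairs-divisorList (suc k) p p-prime p-inj = begin
    2 * ∑pairs twiceInvDist (D ++ qA) + 3 * (2 * t)    ≡⟨ cong (λ z → 2 * z + 3 * (2 * t)) ∑pairs-doubling ⟩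
    2 * (s + (length D * length D + ∑∑ 𝟙∣ D D) + s) + 3 * (2 * t)
      ≡⟨ cong₂ (λ l x → 2 * (s + (l * l + x) + s) + 3 * (2 * t))
               (length-divisorList k (tail p)) (∑∑-𝟙∣-divisorList k (tail p) p-prime′ p-inj′) ⟩
    2 * (s + (t * t + r) + s) + 3 * (2 * t)
      ≡⟨ solve 3 (λ S T R → con 2 :* (S :+ (T :* T :+ R) :+ S) :+ con 3 :* (con 2 :* T)
                         := con 2 :* (con 2 :* S :+ con 3 :* T) :+ con 2 :* (T :* T) :+ con 2 :* R) refl s t r ⟩
    2 * (2 * s + 3 * t) + 2 * (t * t) + 2 * r
      ≡⟨ cong (λ z → 2 * z + 2 * (t * t) + 2 * r) (∑pairs-divisorList k (tail p) p-prime′ p-inj′) ⟩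
    2 * (t * t + 2 * r) + 2 * (t * t) + 2 * r
      ≡⟨ solve 2 (λ T R → con 2 :* (T :* T :+ con 2 :* R) :+ con 2 :* (T :* T) :+ con 2 :* R
                       := (con 2 :* T) :* (con 2 :* T) :+ con 2 :* (con 3 :* R)) refl t r ⟩
    (2 * t) * (2 * t) + 2 * (3 * r)                     ∎
  where
  open ≡-Reasoning
  open Doubling (p-prime zero) (head∤∏tail p p-prime p-inj) (divisorList-∣ k (tail p))
  p-prime′ : ∀ i → Prime (tail p i)
  p-prime′ = p-prime ∘ suc
  p-inj′ : Injective _≡_ _≡_ (tail p)
  p-inj′ = Fin.suc-injective ∘ p-inj
  D = divisorList k (tail p)
  s = ∑pairs twiceInvDist D
  t = 2 ^ k
  r = 3 ^ k

any-true : ∀ (f : ℕ → Bool) {w xs} → w ∈ xs → f w ≡ true → any f xs ≡ true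
any-true f w∈xs fw≡true = Equivalence.to T-≡ (any⁺ f (lose w∈xs (Equivalence.from T-≡ fw≡true)))

≢⇒≡ᵇ-false : ∀ {x y} → x ≢ y → (x ≡ᵇ y) ≡ false
≢⇒≡ᵇ-false {x} {y} = dec-false (x ≟ y)

any-∧-≡ᵇ : ∀ (b : ℕ → Bool) {y xs} → y ∈ xs → any (λ w → b w ∧ (w ≡ᵇ y)) xs ≡ b y
any-∧-≡ᵇ b {y} {xs} y∈xs with b y in by
... | true  = any-true _ y∈xs (cong₂ _∧_ by (dec-true (y ≟ y) refl))
... | false = none xs
  where
  none : ∀ ws → any (λ w → b w ∧ (w ≡ᵇ y)) ws ≡ false
  none []       = refl
  none (w ∷ ws) with w ≟ y
  ... | yes refl rewrite by = none ws
  ... | no w≢y   rewrite ≢⇒≡ᵇ-false w≢y | ∧-zeroʳ (b w) = none ws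

module _ (G : FinGraph) where

  walkOfLength-1 : ∀ {x y} → y ∈ vertices G → walkOfLength G 1 x y ≡ adj G x y
  walkOfLength-1 {x} = any-∧-≡ᵇ (adj G x)

  walkOfLength-2 : ∀ {x w y} → w ∈ vertices G → adj G x w ≡ true → walkOfLength G 1 w y ≡ true →
                   walkOfLength G 2 x y ≡ true
  walkOfLength-2 w∈V xw wy = any-true _ w∈V (cong₂ _∧_ xw wy)

leastFrom-1 : ∀ {P fuel} → P 0 ≡ false → P 1 ≡ true → 1 ≤ fuel → leastFrom P fuel 0 ≡ 1
leastFrom-1 {fuel = suc zero}    P0 P1 (s≤s _) rewrite P0 | P1 = refl
leastFrom-1 {fuel = suc (suc _)} P0 P1 (s≤s _) rewrite P0 | P1 = refl

leastFrom-2 : ∀ {P fuel} → P 0 ≡ false → P 1 ≡ false → P 2 ≡ true → 2 ≤ fuel → leastFrom P fuel 0 ≡ 2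
leastFrom-2 {fuel = suc (suc zero)}    P0 P1 P2 (s≤s (s≤s _)) rewrite P0 | P1 | P2 = refl
leastFrom-2 {fuel = suc (suc (suc _))} P0 P1 P2 (s≤s (s≤s _)) rewrite P0 | P1 | P2 = refl

length≥2 : ∀ {x y} {xs : List ℕ} → x ∈ xs → y ∈ xs → x ≢ y → 2 ≤ length xs
length≥2 {xs = _ ∷ _ ∷ _}  _          _          _   = s≤s (s≤s z≤n)
length≥2 {xs = _ ∷ []}     (here refl) (here refl) x≢y = contradiction refl x≢y
length≥2 {xs = _ ∷ []}     (there ())  _          _
length≥2 {xs = _ ∷ []}     _          (there ())  _

comparableᵇ-1ˡ : ∀ y → comparableᵇ 1 y ≡ true
comparableᵇ-1ˡ y = cong (_∨ (y ∣ᵇ 1)) (1∣ᵇ y)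

comparableᵇ-1ʳ : ∀ x → comparableᵇ x 1 ≡ true
comparableᵇ-1ʳ x = trans (cong ((x ∣ᵇ 1) ∨_) (1∣ᵇ x)) (∨-zeroʳ (x ∣ᵇ 1))

module _ (n : ℕ) .{{_ : NonZero n}} where

  private
    G = divisorGraph n
    V = vertices G

  ∈-divisorGraph⇔∣ : ∀ {x} → x ∈ V ⇔ x ∣ n
  ∈-divisorGraph⇔∣ = mk⇔ (λ x∈V → proj₂ (∈-filter⁻ (_∣? n) {xs = map suc (upTo n)} x∈V)) ∣⇒∈V
    where
    ∣⇒∈V : ∀ {x} → x ∣ n → x ∈ V
    ∣⇒∈V {zero}  0∣n = contradiction (0∣⇒≡0 0∣n) (≢-nonZero⁻¹ n)
    ∣⇒∈V {suc x} x∣n = ∈-filter⁺ (_∣? n) (∈-map⁺ suc (∈-upTo⁺ (∣⇒≤ x∣n))) x∣n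

  divisorGraph-unique : Unique V
  divisorGraph-unique = Unique.filter⁺ (_∣? n) (Unique.map⁺ suc-injective (Unique.upTo⁺ n))

  adj-divisorGraph : ∀ {x y} → x ≢ y → adj G x y ≡ comparableᵇ x y
  adj-divisorGraph x≢y rewrite ≢⇒≡ᵇ-false x≢y = refl

  dist-divisorGraph : ∀ {x y} → x ∈ V → y ∈ V → x ≢ y → dist G x y ≡ (if comparableᵇ x y then 1 else 2)
  dist-divisorGraph {x} {y} x∈V y∈V x≢y with comparableᵇ x y in xy
  ... | true  = leastFrom-1 (≢⇒≡ᵇ-false x≢y) (trans (walkOfLength-1 G {x} y∈V) (trans (adj-divisorGraph x≢y) xy))
                            (<⇒≤ (length≥2 x∈V y∈V x≢y))
  ... | false = leastFrom-2 (≢⇒≡ᵇ-false x≢y) (trans (walkOfLength-1 G {x} y∈V) (trans (adj-divisorGraph x≢y) xy))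
                            (walkOfLength-2 G {x} 1∈V x~1 1~y) (length≥2 x∈V y∈V x≢y)
    where
    1∈V : 1 ∈ V
    1∈V = Equivalence.from ∈-divisorGraph⇔∣ (1∣ n)
    x≢1 : x ≢ 1
    x≢1 refl = contradiction (trans (sym (comparableᵇ-1ˡ y)) xy) λ ()
    y≢1 : y ≢ 1
    y≢1 refl = contradiction (trans (sym (comparableᵇ-1ʳ x)) xy) λ ()
    x~1 : adj G x 1 ≡ true
    x~1 = trans (adj-divisorGraph x≢1) (comparableᵇ-1ʳ x)
    1~y : walkOfLength G 1 1 y ≡ true
    1~y = trans (walkOfLength-1 G {1} y∈V) (trans (adj-divisorGraph (y≢1 ∘ sym)) (comparableᵇ-1ˡ y))

fromℤ : ℤ → ℚ
fromℤ i = i ℚ./ 1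

fromℕ : ℕ → ℚ
fromℕ n = fromℤ (ℤ.+ n)

fromℤ≡mkℚ : ∀ i → fromℤ i ≡ mkℚ i 0 (C.sym (C.1-coprimeTo ℤ.∣ i ∣))
fromℤ≡mkℚ (ℤ.+ n)  = ℚ.normalize-coprime (C.sym (C.1-coprimeTo n))
fromℤ≡mkℚ -[1+ n ] = cong -_ (ℚ.normalize-coprime (C.sym (C.1-coprimeTo (suc n))))

fromℤ-+ : ∀ a b → fromℤ (a ℤ.+ b) ≡ fromℤ a ℚ.+ fromℤ b
fromℤ-+ a b rewrite fromℤ≡mkℚ a | fromℤ≡mkℚ b | ℤ.*-identityʳ a | ℤ.*-identityʳ b = refl

fromℤ-* : ∀ a b → fromℤ (a ℤ.* b) ≡ fromℤ a ℚ.* fromℤ b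
fromℤ-* a b rewrite fromℤ≡mkℚ a | fromℤ≡mkℚ b = refl

fromℤ-neg : ∀ a → fromℤ (ℤ.- a) ≡ - fromℤ a
fromℤ-neg a rewrite fromℤ≡mkℚ a | fromℤ≡mkℚ (ℤ.- a) with a
... | +0       = refl
... | +[1+ n ] = refl
... | -[1+ n ] = refl

fromℕ-+ : ∀ a b → fromℕ (a + b) ≡ fromℕ a ℚ.+ fromℕ b
fromℕ-+ a b = trans (cong fromℤ (ℤ.pos-+ a b)) (fromℤ-+ (ℤ.+ a) (ℤ.+ b))

fromℕ-* : ∀ a b → fromℕ (a * b) ≡ fromℕ a ℚ.* fromℕ b
fromℕ-* a b = trans (cong fromℤ (ℤ.pos-* a b)) (fromℤ-* (ℤ.+ a) (ℤ.+ b))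

half*fromℕ≡hararyFormula : ∀ k s → 2 * s + 3 * 2 ^ k ≡ 2 ^ k * 2 ^ k + 2 * 3 ^ k →
                           half ℚ.* fromℕ s ≡ hararyFormula k
half*fromℕ≡hararyFormula k s eq = cong (half ℚ.*_) (begin
  x                                                ≡⟨ Q.solve 2 (λ x t → x Q.:= Q.con half Q.:* ((Q.con two Q.:* x Q.:+ Q.con three Q.:* t) Q.:- Q.con three Q.:* t)) refl x t ⟩
  half ℚ.* ((two ℚ.* x ℚ.+ three ℚ.* t) ℚ.- three ℚ.* t) ≡⟨ cong (λ z → half ℚ.* (z ℚ.- three ℚ.* t)) eqℚ ⟩
  half ℚ.* ((t ℚ.* t ℚ.+ two ℚ.* r) ℚ.- three ℚ.* t)   ≡⟨ Q.solve 2 (λ t r → Q.con half Q.:* ((t Q.:* t Q.:+ Q.con two Q.:* r) Q.:- Q.con three Q.:* t) Q.:= Q.con half Q.:* (t Q.:* (t Q.:+ Q.:- Q.con three)) Q.:+ r) refl t r ⟩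
  half ℚ.* (t ℚ.* (t ℚ.+ - three)) ℚ.+ r          ≡⟨ cong (λ z → half ℚ.* z ℚ.+ r) (sym product) ⟩
  half ℚ.* fromℤ (ℤ.+ 2 ^ k ℤ.* (ℤ.+ 2 ^ k ℤ.- ℤ.+ 3)) ℚ.+ r ∎)
  where
  open ≡-Reasoning
  module Q = ℚ-Solver.+-*-Solver
  x = fromℕ s
  t = fromℕ (2 ^ k)
  r = fromℕ (3 ^ k)
  two = fromℕ 2
  three = fromℕ 3
  eqℚ : two ℚ.* x ℚ.+ three ℚ.* t ≡ t ℚ.* t ℚ.+ two ℚ.* r
  eqℚ = begin
    two ℚ.* x ℚ.+ three ℚ.* t       ≡⟨ cong₂ ℚ._+_ (fromℕ-* 2 s) (fromℕ-* 3 (2 ^ k)) ⟨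
    fromℕ (2 * s) ℚ.+ fromℕ (3 * 2 ^ k) ≡⟨ fromℕ-+ (2 * s) (3 * 2 ^ k) ⟨
    fromℕ (2 * s + 3 * 2 ^ k)         ≡⟨ cong fromℕ eq ⟩
    fromℕ (2 ^ k * 2 ^ k + 2 * 3 ^ k) ≡⟨ fromℕ-+ (2 ^ k * 2 ^ k) (2 * 3 ^ k) ⟩
    fromℕ (2 ^ k * 2 ^ k) ℚ.+ fromℕ (2 * 3 ^ k) ≡⟨ cong₂ ℚ._+_ (fromℕ-* (2 ^ k) (2 ^ k)) (fromℕ-* 2 (3 ^ k)) ⟩
    t ℚ.* t ℚ.+ two ℚ.* r             ∎
  product : fromℤ (ℤ.+ 2 ^ k ℤ.* (ℤ.+ 2 ^ k ℤ.- ℤ.+ 3)) ≡ t ℚ.* (t ℚ.+ - three)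
  product = trans (fromℤ-* (ℤ.+ 2 ^ k) _) (cong (t ℚ.*_) (trans (fromℤ-+ (ℤ.+ 2 ^ k) (ℤ.- ℤ.+ 3)) (cong (t ℚ.+_) (fromℤ-neg (ℤ.+ 3)))))

half*fromℕ-+ : ∀ a b → half ℚ.* fromℕ a ℚ.+ half ℚ.* fromℕ b ≡ half ℚ.* fromℕ (a + b)
half*fromℕ-+ a b = trans (sym (ℚ.*-distribˡ-+ half (fromℕ a) (fromℕ b))) (cong (half ℚ.*_) (sym (fromℕ-+ a b)))

sumℚ-++ : ∀ xs ys → sumℚ (xs ++ ys) ≡ sumℚ xs ℚ.+ sumℚ ys
sumℚ-++ []       ys = sym (ℚ.+-identityˡ (sumℚ ys))
sumℚ-++ (x ∷ xs) ys = trans (cong (x ℚ.+_) (sumℚ-++ xs ys)) (sym (ℚ.+-assoc x (sumℚ xs) (sumℚ ys)))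

sumℚ-half : ∀ {P : ℕ → Set} {f : ℕ → ℚ} {g xs} → All P xs → (∀ {y} → P y → f y ≡ half ℚ.* fromℕ (g y)) →
            sumℚ (map f xs) ≡ half ℚ.* fromℕ (∑ g xs)
sumℚ-half []                 f≡g = refl
sumℚ-half {g = g} {xs = x ∷ xs} (px ∷ pxs) f≡g =
  trans (cong₂ ℚ._+_ (f≡g px) (sumℚ-half pxs f≡g)) (half*fromℕ-+ (g x) (∑ g xs))

sumℚ-pairs : ∀ {P : ℕ → Set} {F : ℕ × ℕ → ℚ} {g xs} → Unique xs → All P xs →
             (∀ {x y} → P x → P y → x ≢ y → F (x , y) ≡ half ℚ.* fromℕ (g x y)) →
             sumℚ (map F (pairs xs)) ≡ half ℚ.* fromℕ (∑pairs g xs)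
sumℚ-pairs [] [] F≡g = refl
sumℚ-pairs {F = F} {g = g} {xs = x ∷ xs} (x≢xs ∷ xs-unique) (px ∷ pxs) F≡g = begin
  sumℚ (map F (map (x ,_) xs ++ pairs xs))                   ≡⟨ cong sumℚ (map-++ F (map (x ,_) xs) (pairs xs)) ⟩
  sumℚ (map F (map (x ,_) xs) ++ map F (pairs xs))           ≡⟨ sumℚ-++ (map F (map (x ,_) xs)) (map F (pairs xs)) ⟩
  sumℚ (map F (map (x ,_) xs)) ℚ.+ sumℚ (map F (pairs xs))  ≡⟨ cong₂ ℚ._+_ row (sumℚ-pairs xs-unique pxs F≡g) ⟩
  half ℚ.* fromℕ (∑ (g x) xs) ℚ.+ half ℚ.* fromℕ (∑pairs g xs) ≡⟨ half*fromℕ-+ (∑ (g x) xs) (∑pairs g xs) ⟩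
  half ℚ.* fromℕ (∑pairs g (x ∷ xs))                         ∎
  where
  open ≡-Reasoning
  row : sumℚ (map F (map (x ,_) xs)) ≡ half ℚ.* fromℕ (∑ (g x) xs)
  row = trans (cong sumℚ (sym (map-∘ xs))) (sumℚ-half (All.zip (pxs , x≢xs)) (λ (py , x≢y) → F≡g px py x≢y))

module _ (n : ℕ) .{{_ : NonZero n}} where

  private
    G = divisorGraph n

  inv-dist-divisorGraph : ∀ {x y} → x ∈ vertices G → y ∈ vertices G → x ≢ y →
                          inv (dist G x y) ≡ half ℚ.* fromℕ (twiceInvDist x y)
  inv-dist-divisorGraph {x} {y} x∈V y∈V x≢y rewrite dist-divisorGraph n x∈V y∈V x≢y with comparableᵇ x y
  ... | true  = refl
  ... | false = refl

  harary-divisorGraph : harary G ≡ half ℚ.* fromℕ (∑pairs twiceInvDist (vertices G))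
  harary-divisorGraph =
    sumℚ-pairs (divisorGraph-unique n) (All.tabulate (λ x∈V → x∈V)) inv-dist-divisorGraph

divisorGraph↭divisorList : ∀ k p → (∀ i → Prime (p i)) → Injective _≡_ _≡_ p →
                           vertices (divisorGraph (∏ p)) ↭ divisorList k p
divisorGraph↭divisorList k p p-prime p-inj = ∼bag⇒↭ (unique∧set⇒bag
  (divisorGraph-unique (∏ p)) (divisorList-unique k p p-prime p-inj)
  (⇔.trans (∈-divisorGraph⇔∣ (∏ p)) (⇔.sym (∈-divisorList⇔∣ k p p-prime))))
  where instance _ = ∏-nonZero p p-prime

theorem3p5 : (k : ℕ) (p : Fin k → ℕ) → (∀ i → Prime (p i)) → Injective _≡_ _≡_ p →
    harary (divisorGraph (foldr _*_ 1 p)) ≡ hararyFormula k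
theorem3p5 k p p-prime p-inj = begin
  harary (divisorGraph (∏ p))                                      ≡⟨ harary-divisorGraph (∏ p) ⟩
  half ℚ.* fromℕ (∑pairs twiceInvDist (vertices (divisorGraph (∏ p)))) ≡⟨ cong (λ s → half ℚ.* fromℕ s) (∑pairs-↭ twiceInvDist-sym (divisorGraph↭divisorList k p p-prime p-inj)) ⟩
  half ℚ.* fromℕ (∑pairs twiceInvDist (divisorList k p))           ≡⟨ half*fromℕ≡hararyFormula k (∑pairs twiceInvDist (divisorList k p)) (∑pairs-divisorList k p p-prime p-inj) ⟩
  hararyFormula k                                                  ∎
  where
  open ≡-Reasoning
  instance _ = ∏-nonZero p p-prime
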